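{- Let $n$ be a positive integer that is a survivor under the map $X$. Then exactly one of the following holds: (i) $n$ is prime; (ii) $n = p\cdot q$ where $p$ and $q$ are distinct odd primes; (iii) $n = 9$.
   Context: For a positive integer $n$, let $\Pi(n)$ denote the sum of the distinct prime divisors of $n$ (so $\Pi(1)=0$), and let $\mathcal{C}(n)$ denote the sum of all positive divisors of $n$ that are not prime (this includes the divisor $1$ and, when $n$ is not prime, $n$ itself; so $\mathcal{C}(1)=1$ and $\mathcal{C}(p)=1$ for $p$ prime). Define $X(n) = \Pi(n) - \mathcal{C}(n) + n$, an integer (in particular $X(1)=0$). For $a\ge 1$ let $X^{(a)}$ denote the $a$-fold iterate of $X$. A positive integer $n$ is called a survivor if $X^{(a)}(n) > 0$ for all $a \ge 1$ (so all iterates are defined and positive). -}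

module Defs where

open import Data.Nat as ℕ using (ℕ; zero; suc)
open import Data.Nat.Divisibility using (_∣_; _∣?_)
open import Data.Nat.Primality using (Prime; prime?)
open import Data.Integer as ℤ using (ℤ; +_; -[1+_])
open import Data.List using (List; filter; map; upTo)
open import Data.Nat.ListAction using (sum)
open import Data.Product using (_×_)
open import Relation.Nullary using (¬_; ¬?)

divisors : ℕ → List ℕ
divisors n = filter (λ d → d ∣? n) (map suc (upTo n))

Π : ℕ → ℕ
Π n = sum (filter prime? (divisors n))

𝒞 : ℕ → ℕ
𝒞 n = sum (filter (λ d → ¬? (prime? d)) (divisors n))

X : ℕ → ℤ
X n = (+ Π n) ℤ.- (+ 𝒞 n) ℤ.+ (+ n)

-- one step of the iteration on integers; only used on positive values
-- (non-positive values are left fixed, they are never relevant for survivors)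
stepX : ℤ → ℤ
stepX (+ m) = X m
stepX -[1+ m ] = -[1+ m ]

iterX : ℕ → ℕ → ℤ
iterX zero n = + n
iterX (suc a) n = stepX (iterX a n)

Survivor : ℕ → Set
Survivor n = ∀ (a : ℕ) → 1 ℕ.≤ a → ℤ.+0 ℤ.< iterX a n

-- If n = p·m with p prime and m ≥ 2 not prime, then X(n) ≤ 0:
-- when p is the only prime factor of n, the non-prime divisors p² and n alone outweigh
-- Π(n) + n; otherwise each prime divisor d ≠ p of n yields the non-prime proper divisor
-- d·p, these are pairwise distinct, and together with n they outweigh Π(n) + n.
-- So a composite survivor is a product of two primes, and there X(p·q) = p + q − 1
-- (p ≠ q) and X(p²) = p − 1. An even survivor 2·m with m an odd prime would produce the
-- smaller even survivor m + 1, hence 2 is the only even survivor, and p² survives only if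
-- the even number p − 1 does, i.e. p = 3.
module Submission where

open import Algebra.Properties.CommutativeSemigroup using (interchange)
open import Data.Bool using (if_then_else_)
open import Data.Empty using (⊥-elim)
open import Data.Integer as ℤ using (_⊖_)
import Data.Integer.Properties as ℤ
open import Data.Integer.Tactic.RingSolver using (solve-∀)
open import Data.List using ([]; _∷_; filter; map; upTo; _++_; [_])
open import Data.List.Properties using (upTo-∷ʳ; map-++)
open import Data.List.Relation.Unary.All using (_∷_)
open import Data.Nat
open import Data.Nat.Divisibility
open import Data.Nat.Induction using (<-rec)
open import Data.Nat.ListAction using (sum; product)
open import Data.Nat.ListAction.Properties using (sum-++)
open import Data.Nat.Primality
open import Data.Nat.Primality.Factorisation using (factorise)
open import Data.Nat.Properties
open import Data.Product using (_×_; _,_; proj₁; proj₂; ∃-syntax)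
open import Data.Sum using (_⊎_; inj₁; inj₂; reduce)
open import Function using (_∘_; id)
open import Level using (Level; 0ℓ)
open import Relation.Binary.PropositionalEquality hiding ([_])
open import Relation.Nullary using (¬_; ¬?; yes; no; does; contradiction)
open import Relation.Nullary.Decidable using (_×-dec_; decidable-stable; from-yes)
open import Relation.Unary using (Pred; Decidable; _⊆_; _≐_; _∪_; _∩_; ∁; _⊥_)
open import Relation.Unary.Properties using (_∪?_; _∩?_; ∁?)

open import Defs

private
  variable
    ℓ ℓ′ : Level
    P : Pred ℕ ℓ
    Q : Pred ℕ ℓ′

∑≤ : ℕ → (ℕ → ℕ) → ℕ
∑≤ zero    f = 0
∑≤ (suc n) f = ∑≤ n f + f (suc n)

sum-map-upTo : ∀ (f : ℕ → ℕ) n → sum (map f (map suc (upTo n))) ≡ ∑≤ n f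
sum-map-upTo f zero    = refl
sum-map-upTo f (suc n) = begin
  sum (map f (map suc (upTo (suc n))))
    ≡⟨ cong (λ ds → sum (map f (map suc ds))) (upTo-∷ʳ n) ⟨
  sum (map f (map suc (upTo n ++ [ n ])))
    ≡⟨ cong (λ ds → sum (map f ds)) (map-++ suc (upTo n) [ n ]) ⟩
  sum (map f (map suc (upTo n) ++ [ suc n ]))
    ≡⟨ cong sum (map-++ f (map suc (upTo n)) [ suc n ]) ⟩
  sum (map f (map suc (upTo n)) ++ [ f (suc n) ])
    ≡⟨ sum-++ (map f (map suc (upTo n))) [ f (suc n) ] ⟩
  sum (map f (map suc (upTo n))) + (f (suc n) + 0)
    ≡⟨ cong₂ _+_ (sum-map-upTo f n) (+-identityʳ (f (suc n))) ⟩
  ∑≤ n f + f (suc n) ∎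
  where open ≡-Reasoning

module _ {f g : ℕ → ℕ} where

  ∑-cong : (∀ d → f d ≡ g d) → ∀ n → ∑≤ n f ≡ ∑≤ n g
  ∑-cong f≗g zero    = refl
  ∑-cong f≗g (suc n) = cong₂ _+_ (∑-cong f≗g n) (f≗g (suc n))

  ∑-mono-≤ : (∀ d → f d ≤ g d) → ∀ n → ∑≤ n f ≤ ∑≤ n g
  ∑-mono-≤ f≤g zero    = z≤n
  ∑-mono-≤ f≤g (suc n) = +-mono-≤ (∑-mono-≤ f≤g n) (f≤g (suc n))

  ∑-distrib-+ : ∀ n → ∑≤ n (λ d → f d + g d) ≡ ∑≤ n f + ∑≤ n g
  ∑-distrib-+ zero    = refl
  ∑-distrib-+ (suc n) = trans (cong (_+ (f (suc n) + g (suc n))) (∑-distrib-+ n))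
                              (interchange +-commutativeSemigroup (∑≤ n f) (∑≤ n g) (f (suc n)) (g (suc n)))

module _ (f : ℕ → ℕ) where

  ∑-distribʳ-* : ∀ k n → ∑≤ n (λ d → f d * k) ≡ ∑≤ n f * k
  ∑-distribʳ-* k zero    = refl
  ∑-distribʳ-* k (suc n) = trans (cong (_+ f (suc n) * k) (∑-distribʳ-* k n))
                                 (sym (*-distribʳ-+ k (∑≤ n f) (f (suc n))))

  ∑-monoˡ-≤ : ∀ {m n} → m ≤ n → ∑≤ m f ≤ ∑≤ n f
  ∑-monoˡ-≤ {n = zero}  z≤n = z≤n
  ∑-monoˡ-≤ {n = suc n} m≤1+n with m≤n⇒m<n∨m≡n m≤1+n
  ... | inj₁ m<1+n = ≤-trans (∑-monoˡ-≤ (s≤s⁻¹ m<1+n)) (m≤m+n (∑≤ n f) (f (suc n)))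
  ... | inj₂ refl  = ≤-refl

  term≤∑ : ∀ {a n} → 1 ≤ a → a ≤ n → f a ≤ ∑≤ n f
  term≤∑ {suc a} _ a<n = ≤-trans (m≤n+m (f (suc a)) (∑≤ a f)) (∑-monoˡ-≤ a<n)

  ∑-vanishing-except : ∀ {a} → (∀ d → d ≢ a → f d ≡ 0) →
                       ∀ {n} → 1 ≤ a → a ≤ n → ∑≤ n f ≡ f a
  ∑-vanishing-except f≡0 {zero} (s≤s _) ()
  ∑-vanishing-except {a} f≡0 {suc n} 1≤a a≤1+n with m≤n⇒m<n∨m≡n a≤1+n
  ... | inj₁ a<1+n = begin
    ∑≤ n f + f (suc n) ≡⟨ cong (∑≤ n f +_) (f≡0 (suc n) (>⇒≢ a<1+n)) ⟩
    ∑≤ n f + 0         ≡⟨ +-identityʳ (∑≤ n f) ⟩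
    ∑≤ n f             ≡⟨ ∑-vanishing-except f≡0 1≤a (s≤s⁻¹ a<1+n) ⟩
    f a                ∎
    where open ≡-Reasoning
  ... | inj₂ refl = cong (_+ f a) (∑-vanishing-below n ≤-refl)
    where
    ∑-vanishing-below : ∀ m → m < a → ∑≤ m f ≡ 0
    ∑-vanishing-below zero    _     = refl
    ∑-vanishing-below (suc m) 1+m<a = cong₂ _+_ (∑-vanishing-below m (<-trans (n<1+n m) 1+m<a))
                                              (f≡0 (suc m) (<⇒≢ 1+m<a))

  ∑-vanishing-tail : ∀ {m} → (∀ d → m < d → f d ≡ 0) → ∀ {n} → m ≤ n → ∑≤ n f ≡ ∑≤ m f
  ∑-vanishing-tail f≡0 {n} m≤n with m≤n⇒m<n∨m≡n m≤n
  ... | inj₂ refl = refl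
  ∑-vanishing-tail {m} f≡0 {suc n} m≤n | inj₁ m<1+n =
    trans (cong₂ _+_ (∑-vanishing-tail f≡0 (s≤s⁻¹ m<1+n)) (f≡0 (suc n) m<1+n))
          (+-identityʳ (∑≤ m f))

  ∑+term≤∑ : ∀ {m n} → m < n → ∑≤ m f + f n ≤ ∑≤ n f
  ∑+term≤∑ {n = suc n} m<1+n = +-monoˡ-≤ (f (suc n)) (∑-monoˡ-≤ (s≤s⁻¹ m<1+n))

  ∑-multiples : ∀ k .{{_ : NonZero k}} n → ∑≤ n (λ d → f (d * k)) ≤ ∑≤ (n * k) f
  ∑-multiples k zero    = z≤n
  ∑-multiples k (suc n) = ≤-trans (+-monoˡ-≤ (f (suc n * k)) (∑-multiples k n))
                                  (∑+term≤∑ (m<n+m (n * k) (>-nonZero⁻¹ k)))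

-- Sums over a decidable subset: ∑≤ n (select P?) is the sum of the d ∈ P with 1 ≤ d ≤ n.

select : Decidable P → ℕ → ℕ
select P? d = if does (P? d) then d else 0

select-yes : (P? : Decidable P) → ∀ {d} → P d → select P? d ≡ d
select-yes P? {d} Pd with P? d
... | yes _  = refl
... | no ¬Pd = contradiction Pd ¬Pd

select-no : (P? : Decidable P) → ∀ {d} → ¬ P d → select P? d ≡ 0
select-no P? {d} ¬Pd with P? d
... | yes Pd = contradiction Pd ¬Pd
... | no _   = refl

select-mono : (P? : Decidable P) (Q? : Decidable Q) → P ⊆ Q → ∀ d → select P? d ≤ select Q? d
select-mono P? Q? P⊆Q d with P? d | Q? d
... | yes _  | yes _  = ≤-refl
... | yes Pd | no ¬Qd = contradiction (P⊆Q Pd) ¬Qd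
... | no _   | _      = z≤n

select-∪ : (P? : Decidable P) (Q? : Decidable Q) → P ⊥ Q →
           ∀ d → select (P? ∪? Q?) d ≡ select P? d + select Q? d
select-∪ P? Q? P⊥Q d with P? d | Q? d
... | yes Pd | yes Qd = ⊥-elim (P⊥Q (Pd , Qd))
... | yes _  | no _   = sym (+-identityʳ d)
... | no _   | yes _  = refl
... | no _   | no _   = refl

select-*-mono : (P? : Decidable P) (Q? : Decidable Q) → ∀ k → (∀ {d} → P d → Q (d * k)) →
                ∀ d → select P? d * k ≤ select Q? (d * k)
select-*-mono P? Q? k P⇒Q d with P? d | Q? (d * k)
... | yes _  | yes _   = ≤-refl
... | yes Pd | no ¬Qdk = contradiction (P⇒Q Pd) ¬Qdk
... | no _   | _       = z≤n

∑-select-mono : (P? : Decidable P) (Q? : Decidable Q) → P ⊆ Q →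
                ∀ n → ∑≤ n (select P?) ≤ ∑≤ n (select Q?)
∑-select-mono P? Q? P⊆Q = ∑-mono-≤ (select-mono P? Q? P⊆Q)

∑-select-cong : (P? : Decidable P) (Q? : Decidable Q) → P ≐ Q →
                ∀ n → ∑≤ n (select P?) ≡ ∑≤ n (select Q?)
∑-select-cong P? Q? (P⊆Q , Q⊆P) n = ≤-antisym (∑-select-mono P? Q? P⊆Q n) (∑-select-mono Q? P? Q⊆P n)

∑-select-∪ : (P? : Decidable P) (Q? : Decidable Q) → P ⊥ Q →
             ∀ n → ∑≤ n (select (P? ∪? Q?)) ≡ ∑≤ n (select P?) + ∑≤ n (select Q?)
∑-select-∪ P? Q? P⊥Q n = trans (∑-cong (select-∪ P? Q? P⊥Q) n) (∑-distrib-+ n)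

∑-select-≡ : ∀ {a n} → 1 ≤ a → a ≤ n → ∑≤ n (select (_≟ a)) ≡ a
∑-select-≡ {a} 1≤a a≤n =
  trans (∑-vanishing-except (select (_≟ a)) (λ d → select-no (_≟ a)) 1≤a a≤n)
        (select-yes (_≟ a) refl)

∑-select-≡∪≡ : ∀ {a b n} → a ≢ b → 1 ≤ a → a ≤ n → 1 ≤ b → b ≤ n →
               ∑≤ n (select ((_≟ a) ∪? (_≟ b))) ≡ a + b
∑-select-≡∪≡ {a} {b} {n} a≢b 1≤a a≤n 1≤b b≤n = begin
  ∑≤ n (select ((_≟ a) ∪? (_≟ b)))
    ≡⟨ ∑-select-∪ (_≟ a) (_≟ b) (λ (d≡a , d≡b) → a≢b (trans (sym d≡a) d≡b)) n ⟩
  ∑≤ n (select (_≟ a)) + ∑≤ n (select (_≟ b))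
    ≡⟨ cong₂ _+_ (∑-select-≡ 1≤a a≤n) (∑-select-≡ 1≤b b≤n) ⟩
  a + b ∎
  where open ≡-Reasoning

filter-filter : ∀ {A : Set} {P : Pred A ℓ} {Q : Pred A ℓ′} (P? : Decidable P) (Q? : Decidable Q) xs →
                filter P? (filter Q? xs) ≡ filter (Q? ∩? P?) xs
filter-filter P? Q? []       = refl
filter-filter P? Q? (x ∷ xs) with Q? x
... | no _ = filter-filter P? Q? xs
... | yes _ with P? x
...   | no _  = filter-filter P? Q? xs
...   | yes _ = cong (x ∷_) (filter-filter P? Q? xs)

sum-filter : (P? : Decidable P) → ∀ xs → sum (filter P? xs) ≡ sum (map (select P?) xs)
sum-filter P? []       = refl
sum-filter P? (x ∷ xs) with P? x
... | no _  = sum-filter P? xs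
... | yes _ = cong (x +_) (sum-filter P? xs)

sum-filter-divisors : (P? : Decidable P) → ∀ n →
                      sum (filter P? (divisors n)) ≡ ∑≤ n (select ((_∣? n) ∩? P?))
sum-filter-divisors P? n = begin
  sum (filter P? (filter (_∣? n) (map suc (upTo n))))
    ≡⟨ cong sum (filter-filter P? (_∣? n) (map suc (upTo n))) ⟩
  sum (filter ((_∣? n) ∩? P?) (map suc (upTo n)))
    ≡⟨ sum-filter ((_∣? n) ∩? P?) (map suc (upTo n)) ⟩
  sum (map (select ((_∣? n) ∩? P?)) (map suc (upTo n)))
    ≡⟨ sum-map-upTo (select ((_∣? n) ∩? P?)) n ⟩
  ∑≤ n (select ((_∣? n) ∩? P?)) ∎
  where open ≡-Reasoning

PrimeDivisor : ℕ → Pred ℕ 0ℓ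
PrimeDivisor n = (_∣ n) ∩ Prime

primeDivisor? : ∀ n → Decidable (PrimeDivisor n)
primeDivisor? n = (_∣? n) ∩? prime?

NonPrimeDivisor : ℕ → Pred ℕ 0ℓ
NonPrimeDivisor n = (_∣ n) ∩ ∁ Prime

nonPrimeDivisor? : ∀ n → Decidable (NonPrimeDivisor n)
nonPrimeDivisor? n = (_∣? n) ∩? ∁? prime?

Π≡∑ : ∀ n → Π n ≡ ∑≤ n (select (primeDivisor? n))
Π≡∑ = sum-filter-divisors prime?

𝒞≡∑ : ∀ n → 𝒞 n ≡ ∑≤ n (select (nonPrimeDivisor? n))
𝒞≡∑ = sum-filter-divisors (∁? prime?)

∑-select+n≤𝒞 : ∀ {n} .{{_ : NonZero n}} → ¬ Prime n → (P? : Decidable P) →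
               P ⊆ NonPrimeDivisor n ∩ ∁ (_≡ n) → ∑≤ n (select P?) + n ≤ 𝒞 n
∑-select+n≤𝒞 {P = P} {n = n} ¬pn P? P⊆ = begin
  ∑≤ n (select P?) + n
    ≡⟨ cong (∑≤ n (select P?) +_) (∑-select-≡ (>-nonZero⁻¹ n) ≤-refl) ⟨
  ∑≤ n (select P?) + ∑≤ n (select (_≟ n))
    ≡⟨ ∑-select-∪ P? (_≟ n) (λ (Pd , d≡n) → proj₂ (P⊆ Pd) d≡n) n ⟨
  ∑≤ n (select (P? ∪? (_≟ n)))
    ≤⟨ ∑-select-mono (P? ∪? (_≟ n)) (nonPrimeDivisor? n) nonPrime n ⟩
  ∑≤ n (select (nonPrimeDivisor? n))
    ≡⟨ 𝒞≡∑ n ⟨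
  𝒞 n ∎
  where
  open ≤-Reasoning
  nonPrime : P ∪ (_≡ n) ⊆ NonPrimeDivisor n
  nonPrime (inj₁ Pd)   = proj₁ (P⊆ Pd)
  nonPrime (inj₂ refl) = ∣-refl , ¬pn

X≡⊖ : ∀ n → X n ≡ (Π n + n) ⊖ 𝒞 n
X≡⊖ n = begin
  ℤ.+ Π n ℤ.- ℤ.+ 𝒞 n ℤ.+ ℤ.+ n   ≡⟨ rearrange (ℤ.+ Π n) (ℤ.+ 𝒞 n) (ℤ.+ n) ⟩
  ℤ.+ Π n ℤ.+ ℤ.+ n ℤ.- ℤ.+ 𝒞 n   ≡⟨ cong (ℤ._- ℤ.+ 𝒞 n) (ℤ.pos-+ (Π n) n) ⟨
  ℤ.+ (Π n + n) ℤ.- ℤ.+ 𝒞 n       ≡⟨ ℤ.[+m]-[+n]≡m⊖n (Π n + n) (𝒞 n) ⟩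
  (Π n + n) ⊖ 𝒞 n                 ∎
  where
  open ≡-Reasoning
  rearrange : ∀ a b c → a ℤ.- b ℤ.+ c ≡ a ℤ.+ c ℤ.- b
  rearrange = solve-∀

Π+n≡𝒞+k⇒X≡k : ∀ n {k} → Π n + n ≡ 𝒞 n + k → X n ≡ ℤ.+ k
Π+n≡𝒞+k⇒X≡k n {k} eq = begin
  X n                    ≡⟨ X≡⊖ n ⟩
  (Π n + n) ⊖ 𝒞 n        ≡⟨ cong (_⊖ 𝒞 n) eq ⟩
  (𝒞 n + k) ⊖ 𝒞 n        ≡⟨ ℤ.⊖-≥ (m≤m+n (𝒞 n) k) ⟩
  ℤ.+ (𝒞 n + k ∸ 𝒞 n)    ≡⟨ cong ℤ.+_ (m+n∸m≡n (𝒞 n) k) ⟩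
  ℤ.+ k                  ∎
  where open ≡-Reasoning

Π+n≤𝒞⇒X≤0 : ∀ n → Π n + n ≤ 𝒞 n → X n ℤ.≤ ℤ.+ 0
Π+n≤𝒞⇒X≤0 n ≤𝒞 = subst (ℤ._≤ ℤ.+ 0) (trans (sym (ℤ.⊖-≤ ≤𝒞)) (sym (X≡⊖ n))) ℤ.neg-≤-pos

iterX-suc : ∀ {n k} → X n ≡ ℤ.+ k → ∀ a → iterX (suc a) n ≡ iterX a k
iterX-suc Xn≡k zero    = Xn≡k
iterX-suc Xn≡k (suc a) = cong stepX (iterX-suc Xn≡k a)

survivor-X : ∀ {n k} → Survivor n → X n ≡ ℤ.+ k → Survivor k
survivor-X s Xn≡k a _ = subst (ℤ.+ 0 ℤ.<_) (iterX-suc Xn≡k a) (s (suc a) (s≤s z≤n))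

Π+n≤𝒞⇒¬survivor : ∀ n → Π n + n ≤ 𝒞 n → ¬ Survivor n
Π+n≤𝒞⇒¬survivor n ≤𝒞 s = ℤ.<-irrefl refl (ℤ.<-≤-trans (s 1 ≤-refl) (Π+n≤𝒞⇒X≤0 n ≤𝒞))

¬survivor-0 : ¬ Survivor 0
¬survivor-0 s with s 1 ≤-refl
... | ℤ.+<+ ()

¬survivor-1 : ¬ Survivor 1
¬survivor-1 s with s 1 ≤-refl
... | ℤ.+<+ ()

prime⇒≥2 : ∀ {p} → Prime p → 2 ≤ p
prime⇒≥2 {p} pp = nonTrivial⇒n>1 p {{prime⇒nonTrivial pp}}

prime⇒≥1 : ∀ {p} → Prime p → 1 ≤ p
prime⇒≥1 = <⇒≤ ∘ prime⇒≥2

prime∣prime⇒≡ : ∀ {p r} → Prime p → Prime r → r ∣ p → r ≡ p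
prime∣prime⇒≡ pp pr r∣p with prime⇒irreducible pp r∣p
... | inj₁ refl = contradiction pr ¬prime[1]
... | inj₂ r≡p  = r≡p

prime∣*⇒≡⊎≡ : ∀ {p q r} → Prime p → Prime q → Prime r → r ∣ p * q → r ≡ p ⊎ r ≡ q
prime∣*⇒≡⊎≡ {p} {q} pp pq pr r∣pq with euclidsLemma p q pr r∣pq
... | inj₁ r∣p = inj₁ (prime∣prime⇒≡ pp pr r∣p)
... | inj₂ r∣q = inj₂ (prime∣prime⇒≡ pq pr r∣q)

¬prime-* : ∀ {a b} → 2 ≤ a → 2 ≤ b → ¬ Prime (a * b)
¬prime-* {a@(suc _)} {b} 2≤a 2≤b pab with prime⇒irreducible pab (m∣m*n {a} b)
... | inj₁ refl = <-irrefl refl 2≤a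
... | inj₂ a≡ab = <-irrefl (sym (*-cancelˡ-≡ b 1 a (trans (sym a≡ab) (sym (*-identityʳ a))))) 2≤b

∃-prime-factor : ∀ {n} → 2 ≤ n → ∃[ p ] (Prime p × p ∣ n)
∃-prime-factor {n} 2≤n with factorise n {{>-nonZero (<-trans z<s 2≤n)}}
... | record { factors = [] ; isFactorisation = n≡1 } = contradiction n≡1 (>⇒≢ 2≤n)
... | record { factors = p ∷ ps ; isFactorisation = n≡p*ps ; factorsPrime = pp ∷ _ } =
  p , pp , divides (product ps) (trans n≡p*ps (*-comm p (product ps)))

nonPrime-multiple∣*⇒≡ : ∀ {p q d} → Prime p → Prime q → p ∣ d → d ∣ p * q → ¬ Prime d → d ≡ p * q
nonPrime-multiple∣*⇒≡ {p} {q} pp pq (divides e refl) ep∣pq ¬pep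
  with prime⇒irreducible pq (*-cancelˡ-∣ p {{prime⇒nonZero pp}} (subst (_∣ p * q) (*-comm e p) ep∣pq))
... | inj₁ refl = contradiction (subst Prime (sym (*-identityˡ p)) pp) ¬pep
... | inj₂ refl = *-comm q p

nonPrime∣*⇒≡1⊎≡ : ∀ {p q d} → Prime p → Prime q → d ∣ p * q → ¬ Prime d → d ≡ 1 ⊎ d ≡ p * q
nonPrime∣*⇒≡1⊎≡ {p} {q} {zero} pp pq 0∣pq _ =
  contradiction (0∣⇒≡0 0∣pq)
                (≢-nonZero⁻¹ (p * q) {{m*n≢0 p q {{prime⇒nonZero pp}} {{prime⇒nonZero pq}}}})
nonPrime∣*⇒≡1⊎≡ {d = 1} _ _ _ _ = inj₁ refl
nonPrime∣*⇒≡1⊎≡ {p} {q} {d@(2+ _)} pp pq d∣pq ¬pd with ∃-prime-factor {d} (s≤s (s≤s z≤n))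
... | r , pr , r∣d with prime∣*⇒≡⊎≡ pp pq pr (∣-trans r∣d d∣pq)
...   | inj₁ refl = inj₂ (nonPrime-multiple∣*⇒≡ pp pq r∣d d∣pq ¬pd)
...   | inj₂ refl = inj₂ (trans (nonPrime-multiple∣*⇒≡ pq pp r∣d (subst (d ∣_) (*-comm p q) d∣pq) ¬pd)
                                (*-comm q p))

+≤* : ∀ {a b} → 2 ≤ a → 2 ≤ b → a + b ≤ a * b
+≤* {a} {suc b} 2≤a (s≤s 1≤b) = begin
  a + suc b     ≤⟨ +-monoʳ-≤ a (+-monoˡ-≤ b 1≤b) ⟩
  a + (b + b)   ≡⟨ cong (λ x → a + (b + x)) (+-identityʳ b) ⟨
  a + 2 * b     ≤⟨ +-monoʳ-≤ a (*-monoˡ-≤ b 2≤a) ⟩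
  a + a * b     ≡⟨ *-suc a b ⟨
  a * suc b     ∎
  where open ≤-Reasoning

2∣⊎2∣suc : ∀ m → 2 ∣ m ⊎ 2 ∣ suc m
2∣⊎2∣suc zero    = inj₁ (divides 0 refl)
2∣⊎2∣suc (suc m) with 2∣⊎2∣suc m
... | inj₁ 2∣m   = inj₂ (∣m∣n⇒∣m+n ∣-refl 2∣m)
... | inj₂ 2∣1+m = inj₁ 2∣1+m

-- X on products of two primes

primeDivisor-*-≐ : ∀ {p q} → Prime p → Prime q → PrimeDivisor (p * q) ≐ (_≡ p) ∪ (_≡ q)
primeDivisor-*-≐ {p} {q} pp pq =
  (λ (d∣pq , pd) → prime∣*⇒≡⊎≡ pp pq pd d∣pq) ,
  λ { (inj₁ refl) → m∣m*n q , pp ; (inj₂ refl) → n∣m*n p , pq }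

nonPrimeDivisor-*-≐ : ∀ {p q} → Prime p → Prime q → NonPrimeDivisor (p * q) ≐ (_≡ 1) ∪ (_≡ p * q)
nonPrimeDivisor-*-≐ {p} {q} pp pq =
  (λ (d∣pq , ¬pd) → nonPrime∣*⇒≡1⊎≡ pp pq d∣pq ¬pd) ,
  λ { (inj₁ refl) → 1∣ (p * q) , ¬prime[1]
    ; (inj₂ refl) → ∣-refl , ¬prime-* (prime⇒≥2 pp) (prime⇒≥2 pq) }

module _ {p q} (pp : Prime p) (pq : Prime q) where

  private instance
    _ = prime⇒nonZero pp
    _ = prime⇒nonZero pq

  Π-*-distinct : p ≢ q → Π (p * q) ≡ p + q
  Π-*-distinct p≢q = begin
    Π (p * q)
      ≡⟨ Π≡∑ (p * q) ⟩
    ∑≤ (p * q) (select (primeDivisor? (p * q)))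
      ≡⟨ ∑-select-cong (primeDivisor? (p * q)) ((_≟ p) ∪? (_≟ q)) (primeDivisor-*-≐ pp pq) (p * q) ⟩
    ∑≤ (p * q) (select ((_≟ p) ∪? (_≟ q)))
      ≡⟨ ∑-select-≡∪≡ p≢q (prime⇒≥1 pp) (m≤m*n p q) (prime⇒≥1 pq) (m≤n*m q p) ⟩
    p + q ∎
    where open ≡-Reasoning

  𝒞-* : 𝒞 (p * q) ≡ 1 + p * q
  𝒞-* = begin
    𝒞 (p * q)
      ≡⟨ 𝒞≡∑ (p * q) ⟩
    ∑≤ (p * q) (select (nonPrimeDivisor? (p * q)))
      ≡⟨ ∑-select-cong (nonPrimeDivisor? (p * q)) ((_≟ 1) ∪? (_≟ p * q))
                       (nonPrimeDivisor-*-≐ pp pq) (p * q) ⟩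
    ∑≤ (p * q) (select ((_≟ 1) ∪? (_≟ p * q)))
      ≡⟨ ∑-select-≡∪≡ 1≢pq ≤-refl 1≤pq 1≤pq ≤-refl ⟩
    1 + p * q ∎
    where
    open ≡-Reasoning
    1≤pq : 1 ≤ p * q
    1≤pq = >-nonZero⁻¹ (p * q) {{m*n≢0 p q}}
    1≢pq : 1 ≢ p * q
    1≢pq 1≡pq = <⇒≢ (prime⇒≥2 pp) (sym (m*n≡1⇒m≡1 p q (sym 1≡pq)))

  X-* : ∀ {s} → 1 ≤ s → Π (p * q) ≡ s → X (p * q) ≡ ℤ.+ (s ∸ 1)
  X-* {suc s} _ Π≡1+s = Π+n≡𝒞+k⇒X≡k (p * q) (begin
    Π (p * q) + p * q   ≡⟨ cong (_+ p * q) Π≡1+s ⟩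
    suc (s + p * q)     ≡⟨ cong suc (+-comm s (p * q)) ⟩
    1 + p * q + s       ≡⟨ cong (_+ s) 𝒞-* ⟨
    𝒞 (p * q) + s       ∎)
    where open ≡-Reasoning

  X-*-distinct : p ≢ q → X (p * q) ≡ ℤ.+ (p + q ∸ 1)
  X-*-distinct p≢q = X-* (≤-trans (prime⇒≥1 pp) (m≤m+n p q)) (Π-*-distinct p≢q)

Π-square : ∀ {p} → Prime p → Π (p * p) ≡ p
Π-square {p} pp = begin
  Π (p * p)
    ≡⟨ Π≡∑ (p * p) ⟩
  ∑≤ (p * p) (select (primeDivisor? (p * p)))
    ≡⟨ ∑-select-cong (primeDivisor? (p * p)) (_≟ p) (reduce ∘ proj₁ ≐p , proj₂ ≐p ∘ inj₁) (p * p) ⟩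
  ∑≤ (p * p) (select (_≟ p))
    ≡⟨ ∑-select-≡ (prime⇒≥1 pp) (m≤m*n p p {{prime⇒nonZero pp}}) ⟩
  p ∎
  where
  open ≡-Reasoning
  ≐p = primeDivisor-*-≐ pp pp

X-square : ∀ {p} → Prime p → X (p * p) ≡ ℤ.+ (p ∸ 1)
X-square pp = X-* pp pp (prime⇒≥1 pp) (Π-square pp)

-- A prime times a non-prime m ≥ 2 is not a survivor

module _ {p m} (pp : Prime p) (2≤m : 2 ≤ m) (¬pm : ¬ Prime m) where

  private
    n = p * m
    instance
      _ = prime⇒nonZero pp
      _ = >-nonZero (<-trans z<s 2≤m)
      _ = m*n≢0 p m

    ¬prime-n : ¬ Prime n
    ¬prime-n = ¬prime-* (prime⇒≥2 pp) 2≤m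

    OtherPrimeDivisor : Pred ℕ 0ℓ
    OtherPrimeDivisor = PrimeDivisor n ∩ ∁ (_≡ p)

    otherPrimeDivisor? : Decidable OtherPrimeDivisor
    otherPrimeDivisor? = primeDivisor? n ∩? ∁? (_≟ p)

    ProperNonPrimeDivisor : Pred ℕ 0ℓ
    ProperNonPrimeDivisor = NonPrimeDivisor n ∩ ∁ (_≡ n)

    properNonPrimeDivisor? : Decidable ProperNonPrimeDivisor
    properNonPrimeDivisor? = nonPrimeDivisor? n ∩? ∁? (_≟ n)

  Π+n≤𝒞-single-prime : PrimeDivisor n ⊆ (_≡ p) → Π n + n ≤ 𝒞 n
  Π+n≤𝒞-single-prime only-p = begin
    Π n + n
      ≡⟨ cong (_+ n) (Π≡∑ n) ⟩
    ∑≤ n (select (primeDivisor? n)) + n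
      ≤⟨ +-monoˡ-≤ n (∑-select-mono (primeDivisor? n) (_≟ p) only-p n) ⟩
    ∑≤ n (select (_≟ p)) + n
      ≡⟨ cong (_+ n) (∑-select-≡ (prime⇒≥1 pp) (m≤m*n p m)) ⟩
    p + n
      ≤⟨ +-monoˡ-≤ n (m≤m*n p p) ⟩
    p * p + n
      ≡⟨ cong (_+ n) (∑-select-≡ (>-nonZero⁻¹ (p * p) {{m*n≢0 p p}}) (∣⇒≤ p*p∣n)) ⟨
    ∑≤ n (select (_≟ p * p)) + n
      ≤⟨ ∑-select+n≤𝒞 ¬prime-n (_≟ p * p) p*p-proper ⟩
    𝒞 n ∎
    where
    open ≤-Reasoning
    p∣m : p ∣ m
    p∣m with ∃-prime-factor 2≤m
    ... | r , pr , r∣m = subst (_∣ m) (only-p (∣-trans r∣m (n∣m*n p) , pr)) r∣m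
    p*p∣n : p * p ∣ n
    p*p∣n = *-monoʳ-∣ p p∣m
    p*p≢n : p * p ≢ n
    p*p≢n pp≡n = ¬pm (subst Prime (*-cancelˡ-≡ p m p pp≡n) pp)
    p*p-proper : (_≡ p * p) ⊆ ProperNonPrimeDivisor
    p*p-proper refl = (p*p∣n , ¬prime-* (prime⇒≥2 pp) (prime⇒≥2 pp)) , p*p≢n

  -- With S the sum of the prime divisors other than p, Π n = p + S ≤ S·p since S ≥ q ≥ 2.
  Π≤∑-other*p : ∀ {q} → Prime q → q ∣ n → q ≢ p →
                Π n ≤ ∑≤ n (λ d → select otherPrimeDivisor? d * p)
  Π≤∑-other*p {q} pq q∣n q≢p = begin
    Π n
      ≡⟨ Π≡∑ n ⟩
    ∑≤ n (select (primeDivisor? n))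
      ≤⟨ ∑-select-mono (primeDivisor? n) ((_≟ p) ∪? otherPrimeDivisor?) split n ⟩
    ∑≤ n (select ((_≟ p) ∪? otherPrimeDivisor?))
      ≡⟨ ∑-select-∪ (_≟ p) otherPrimeDivisor? (λ (d≡p , _ , d≢p) → d≢p d≡p) n ⟩
    ∑≤ n (select (_≟ p)) + S
      ≡⟨ cong (_+ S) (∑-select-≡ (prime⇒≥1 pp) (m≤m*n p m)) ⟩
    p + S
      ≤⟨ ≤-trans (≤-reflexive (+-comm p S)) (+≤* 2≤S (prime⇒≥2 pp)) ⟩
    S * p
      ≡⟨ ∑-distribʳ-* (select otherPrimeDivisor?) p n ⟨
    ∑≤ n (λ d → select otherPrimeDivisor? d * p) ∎
    where
    open ≤-Reasoning
    S = ∑≤ n (select otherPrimeDivisor?)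
    split : PrimeDivisor n ⊆ (_≡ p) ∪ OtherPrimeDivisor
    split {d} pd with d ≟ p
    ... | yes d≡p = inj₁ d≡p
    ... | no d≢p  = inj₂ (pd , d≢p)
    2≤S : 2 ≤ S
    2≤S = begin
      2                            ≤⟨ prime⇒≥2 pq ⟩
      q                            ≡⟨ select-yes otherPrimeDivisor? ((q∣n , pq) , q≢p) ⟨
      select otherPrimeDivisor? q  ≤⟨ term≤∑ (select otherPrimeDivisor?) (prime⇒≥1 pq) (∣⇒≤ q∣n) ⟩
      S                            ∎

  ∑-other*p≤∑-proper : ∑≤ n (λ d → select otherPrimeDivisor? d * p) ≤
                       ∑≤ n (select properNonPrimeDivisor?)
  ∑-other*p≤∑-proper = begin
    ∑≤ n (λ d → select otherPrimeDivisor? d * p)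
      ≤⟨ ∑-mono-≤ (select-*-mono otherPrimeDivisor? properNonPrimeDivisor? p other*p-proper) n ⟩
    ∑≤ n (λ d → select properNonPrimeDivisor? (d * p))
      ≤⟨ ∑-multiples (select properNonPrimeDivisor?) p n ⟩
    ∑≤ (n * p) (select properNonPrimeDivisor?)
      ≡⟨ ∑-vanishing-tail (select properNonPrimeDivisor?) beyond-n (m≤m*n n p) ⟩
    ∑≤ n (select properNonPrimeDivisor?) ∎
    where
    open ≤-Reasoning
    other*p-proper : ∀ {d} → OtherPrimeDivisor d → ProperNonPrimeDivisor (d * p)
    other*p-proper {d} ((d∣n , pd) , d≢p) = (d*p∣n , ¬prime-* (prime⇒≥2 pd) (prime⇒≥2 pp)) , d*p≢n
      where
      d∣m : d ∣ m
      d∣m with euclidsLemma p m pd d∣n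
      ... | inj₁ d∣p = contradiction (prime∣prime⇒≡ pp pd d∣p) d≢p
      ... | inj₂ d∣m = d∣m
      d*p∣n : d * p ∣ n
      d*p∣n = subst (d * p ∣_) (*-comm m p) (*-monoˡ-∣ p d∣m)
      d*p≢n : d * p ≢ n
      d*p≢n dp≡n = ¬pm (subst Prime (*-cancelʳ-≡ d m p (trans dp≡n (*-comm p m))) pd)
    beyond-n : ∀ d → n < d → select properNonPrimeDivisor? d ≡ 0
    beyond-n d n<d = select-no properNonPrimeDivisor? λ ((d∣n , _) , _) → <⇒≱ n<d (∣⇒≤ d∣n)

  Π+n≤𝒞-two-primes : ∀ {q} → Prime q → q ∣ n → q ≢ p → Π n + n ≤ 𝒞 n
  Π+n≤𝒞-two-primes pq q∣n q≢p = begin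
    Π n + n                                    ≤⟨ +-monoˡ-≤ n (Π≤∑-other*p pq q∣n q≢p) ⟩
    ∑≤ n (λ d → select otherPrimeDivisor? d * p) + n ≤⟨ +-monoˡ-≤ n ∑-other*p≤∑-proper ⟩
    ∑≤ n (select properNonPrimeDivisor?) + n   ≤⟨ ∑-select+n≤𝒞 ¬prime-n properNonPrimeDivisor? id ⟩
    𝒞 n                                        ∎
    where open ≤-Reasoning

  Π+n≤𝒞-prime*nonPrime : Π n + n ≤ 𝒞 n
  Π+n≤𝒞-prime*nonPrime with anyUpTo? (λ q → primeDivisor? n q ×-dec ¬? (q ≟ p)) (suc n)
  ... | yes (q , _ , (q∣n , pq) , q≢p) = Π+n≤𝒞-two-primes pq q∣n q≢p
  ... | no ∄q = Π+n≤𝒞-single-prime only-p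
    where
    only-p : PrimeDivisor n ⊆ (_≡ p)
    only-p {d} (d∣n , pd) =
      decidable-stable (d ≟ p) λ d≢p → ∄q (d , s≤s (∣⇒≤ d∣n) , (d∣n , pd) , d≢p)

  ¬survivor-prime*nonPrime : ¬ Survivor n
  ¬survivor-prime*nonPrime = Π+n≤𝒞⇒¬survivor n Π+n≤𝒞-prime*nonPrime

survivor-¬prime⇒semiprime : ∀ {n} → Survivor n → ¬ Prime n →
                            ∃[ p ] ∃[ q ] (Prime p × Prime q × n ≡ p * q)
survivor-¬prime⇒semiprime {0} s _ = contradiction s ¬survivor-0
survivor-¬prime⇒semiprime {1} s _ = contradiction s ¬survivor-1
survivor-¬prime⇒semiprime {n@(2+ _)} s ¬pn with ∃-prime-factor {n} (s≤s (s≤s z≤n))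
... | p , pp , divides 0 ()
... | p , pp , divides 1 n≡1*p = contradiction (subst Prime (sym (trans n≡1*p (*-identityˡ p))) pp) ¬pn
... | p , pp , divides m@(2+ _) n≡m*p with prime? m
...   | yes pm = p , m , pp , pm , trans n≡m*p (*-comm m p)
...   | no ¬pm = contradiction (subst Survivor (trans n≡m*p (*-comm m p)) s)
                               (¬survivor-prime*nonPrime pp (s≤s (s≤s z≤n)) ¬pm)

even-survivor≡2 : ∀ n → Survivor n → 2 ∣ n → n ≡ 2
even-survivor≡2 = <-rec _ go
  where
  go : ∀ n → (∀ {k} → k < n → Survivor k → 2 ∣ k → k ≡ 2) → Survivor n → 2 ∣ n → n ≡ 2
  go _ _   s (divides 0 refl) = contradiction s ¬survivor-0
  go _ _   _ (divides 1 refl) = refl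
  go _ _   s (divides 2 refl) = contradiction (survivor-X s (X-square prime[2])) ¬survivor-1
  go _ rec s (divides m@(suc (suc (suc _))) refl) with prime? m
  ... | no ¬pm = contradiction (subst Survivor (*-comm m 2) s)
                               (¬survivor-prime*nonPrime prime[2] (s≤s (s≤s z≤n)) ¬pm)
  ... | yes pm = contradiction (rec 1+m<m*2 s′ 2∣1+m) λ ()
    where
    s′ : Survivor (suc m)
    s′ = survivor-X (subst Survivor (*-comm m 2) s) (X-*-distinct prime[2] pm λ ())
    2∣1+m : 2 ∣ suc m
    2∣1+m with 2∣⊎2∣suc m
    ... | inj₁ 2∣m   = contradiction (prime∣prime⇒≡ pm prime[2] 2∣m) λ ()
    ... | inj₂ 2∣1+m = 2∣1+m
    1+m<m*2 : suc m < m * 2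
    1+m<m*2 = begin-strict
      suc m      ≡⟨ +-comm 1 m ⟩
      m + 1      <⟨ +-monoʳ-< m (s≤s (s≤s z≤n)) ⟩
      m + m      ≡⟨ cong (m +_) (+-identityʳ m) ⟨
      2 * m      ≡⟨ *-comm 2 m ⟩
      m * 2      ∎
      where open ≤-Reasoning

odd-square-survivor⇒≡3 : ∀ {p} → Prime p → ¬ 2 ∣ p → Survivor (p * p) → p ≡ 3
odd-square-survivor⇒≡3 {0}     pp _   _ = contradiction pp ¬prime[0]
odd-square-survivor⇒≡3 {suc k} pp 2∤p s = cong suc (even-survivor≡2 k (survivor-X s (X-square pp)) 2∣k)
  where
  2∣k : 2 ∣ k
  2∣k with 2∣⊎2∣suc k
  ... | inj₁ 2∣k   = 2∣k
  ... | inj₂ 2∣1+k = contradiction 2∣1+k 2∤p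

DistinctOddPrimeProduct : ℕ → Set
DistinctOddPrimeProduct n =
  ∃[ p ] ∃[ q ] (Prime p × Prime q × p ≢ q × ¬ (2 ∣ p) × ¬ (2 ∣ q) × n ≡ p * q)

survivor-classification : ∀ {n} → Survivor n → Prime n ⊎ DistinctOddPrimeProduct n ⊎ n ≡ 9
survivor-classification {n} s with prime? n
... | yes pn = inj₁ pn
... | no ¬pn with 2 ∣? n
...   | yes 2∣n = contradiction (subst Prime (sym (even-survivor≡2 n s 2∣n)) prime[2]) ¬pn
...   | no 2∤n with survivor-¬prime⇒semiprime s ¬pn
...     | p , q , pp , pq , refl with p ≟ q
...       | no p≢q   =
  inj₂ (inj₁ (p , q , pp , pq , p≢q , 2∤n ∘ ∣m⇒∣m*n q , 2∤n ∘ ∣n⇒∣m*n p , refl))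
...       | yes refl =
  inj₂ (inj₂ (cong (λ x → x * x) (odd-square-survivor⇒≡3 pp (2∤n ∘ ∣m⇒∣m*n p) s)))

prime⇒¬semiprime : ∀ {n p q} → Prime n → Prime p → Prime q → n ≢ p * q
prime⇒¬semiprime pn pp pq refl = ¬prime-* (prime⇒≥2 pp) (prime⇒≥2 pq) pn

¬prime[9] : ¬ Prime 9
¬prime[9] = ¬prime-* {3} {3} (s≤s (s≤s z≤n)) (s≤s (s≤s z≤n))

prime∣9⇒≡3 : ∀ {p} → Prime p → p ∣ 9 → p ≡ 3
prime∣9⇒≡3 pp p∣9 = reduce (prime∣*⇒≡⊎≡ prime[3] prime[3] pp p∣9)
  where
  prime[3] : Prime 3
  prime[3] = from-yes (prime? 3)

¬distinctOddPrimeProduct[9] : ¬ DistinctOddPrimeProduct 9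
¬distinctOddPrimeProduct[9] (p , q , pp , pq , p≢q , _ , _ , 9≡pq) =
  p≢q (trans (prime∣9⇒≡3 pp (subst (p ∣_) (sym 9≡pq) (m∣m*n q)))
             (sym (prime∣9⇒≡3 pq (subst (q ∣_) (sym 9≡pq) (n∣m*n p)))))

mainTheorem1 : (n : ℕ) → 0 < n → Survivor n →
    let P₁ = Prime n
        P₂ = ∃[ p ] ∃[ q ] (Prime p × Prime q × p ≢ q × ¬ (2 ∣ p) × ¬ (2 ∣ q) × n ≡ p * q)
        P₃ = n ≡ 9
    in (P₁ ⊎ P₂ ⊎ P₃) × ¬ (P₁ × P₂) × ¬ (P₁ × P₃) × ¬ (P₂ × P₃)
mainTheorem1 n _ s =
  survivor-classification s ,
  (λ (pn , (p , q , pp , pq , _ , _ , _ , n≡pq)) → prime⇒¬semiprime pn pp pq n≡pq) ,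
  (λ (pn , n≡9) → ¬prime[9] (subst Prime n≡9 pn)) ,
  (λ (P₂ , n≡9) → ¬distinctOddPrimeProduct[9] (subst DistinctOddPrimeProduct n≡9 P₂))
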